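{- Let $Y$ be an invariant set and let $X$ be a finitely supported subset of $Y$ such that $X$ is not FSM uniformly infinite. Then the set $\wp_{us}(X)$ (regarded as a finitely supported subset of the invariant set $\wp_{fs}(Y)$) is not FSM uniformly infinite, i.e. $\wp_{us}(X)$ has no infinite subset all of whose elements are supported by one common finite set of atoms.
   Context: Fix an infinite set $A$ whose elements are called atoms. $S_A$ is the group of all bijections of $A$ that are compositions of finitely many transpositions $(a\,b)$. An $S_A$-set is a set with a group action $\cdot$ of $S_A$. For $S\subseteq A$, $Fix(S)=\{\pi\in S_A:\pi(a)=a\ \forall a\in S\}$; $S$ supports $x$ if $\pi\cdot x=x$ for all $\pi\in Fix(S)$; if $x$ has a finite supporting set, the least finite supporting set exists and is denoted $supp(x)$. An invariant set is an $S_A$-set in which every element has a finite supporting set. For an $S_A$-set $Y$, the powerset carries the action $\pi\star Z=\{\pi\cdot z: z\in Z\}$, and $\wp_{fs}(Y)$ denotes the set of subsets of $Y$ that are finitely supported with respect to $\star$; for $Y$ invariant, $\wp_{fs}(Y)$ is an invariant set. A finitely supported subset of $Y$ is an element of $\wp_{fs}(Y)$. A set $Z$ is uniformly supported if there is a finite $S\subseteq A$ supporting every element of $Z$. For $X\in\wp_{fs}(Y)$, $\wp_{us}(X)$ is the set of all uniformly supported subsets of $X$ (including $\emptyset$); it is a subset of $\wp_{fs}(Y)$ supported by $supp(X)$. A finitely supported subset $X$ of an invariant set is called FSM uniformly infinite if it contains an infinite uniformly supported subset, and FSM non-uniformly infinite otherwise. -}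

module Defs where

open import Level using (Lift)
open import Data.Product using (Σ; ∃; ∃-syntax; _×_; _,_)
open import Data.List using (List; []; _∷_; _++_)
open import Data.List.Membership.Propositional using (_∈_)
open import Data.List.Relation.Unary.Any using (Any)
open import Relation.Nullary using (¬_; yes; no)
open import Relation.Binary.PropositionalEquality using (_≡_)
open import Relation.Binary.Definitions using (DecidableEquality)

InfiniteAtoms : (A : Set) → Set
InfiniteAtoms A = (l : List A) → ∃[ a ] ¬ (a ∈ l)

module FSM (A : Set) (_≟_ : DecidableEquality A) where

  swap : A → A → A → A
  swap a b c with c ≟ a
  ... | yes _ = b
  ... | no _ with c ≟ b
  ...   | yes _ = a
  ...   | no _ = c

  -- An element of S_A, presented as a finite composition of
  -- transpositions:  (a₁,b₁) ∷ … ∷ (aₙ,bₙ) ∷ []  denotes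
  -- the bijection (a₁ b₁) ∘ … ∘ (aₙ bₙ)  (the empty list is id).
  Perm : Set
  Perm = List (A × A)

  ⟦_⟧ : Perm → A → A
  ⟦ [] ⟧ c = c
  ⟦ (a , b) ∷ p ⟧ c = swap a b (⟦ p ⟧ c)

  Fix : List A → Perm → Set
  Fix S π = ∀ a → a ∈ S → ⟦ π ⟧ a ≡ a

  -- S_A-sets: a set with a group action of S_A.  The action depends
  -- only on the bijection ⟦ π ⟧ (·-ext), the identity acts trivially
  -- and composition (list append) acts as composition.

  record SASet : Set₁ where
    field
      Carrier : Set
      _·_     : Perm → Carrier → Carrier
      ·-id    : ∀ x → ([] · x) ≡ x
      ·-comp  : ∀ π σ x → ((π ++ σ) · x) ≡ (π · (σ · x))
      ·-ext   : ∀ π σ → (∀ a → ⟦ π ⟧ a ≡ ⟦ σ ⟧ a) → ∀ x → (π · x) ≡ (σ · x)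

  module _ (Y : SASet) where
    open SASet Y

    Supports : List A → Carrier → Set
    Supports S x = ∀ π → Fix S π → (π · x) ≡ x

    Invariant : Set
    Invariant = ∀ x → ∃[ S ] Supports S x

    Subset : Set₁
    Subset = Carrier → Set

    _⊆_ : Subset → Subset → Set
    U ⊆ X = ∀ x → U x → X x

    _≐_ : Subset → Subset → Set
    Z ≐ W = (Z ⊆ W) × (W ⊆ Z)

    _⋆_ : Perm → Subset → Subset
    (π ⋆ Z) y = ∃[ z ] (Z z × ((π · z) ≡ y))

    SupportsSubset : List A → Subset → Set
    SupportsSubset S Z = ∀ π → Fix S π → (π ⋆ Z) ≐ Z

    FinSuppSubset : Subset → Set
    FinSuppSubset Z = ∃[ S ] SupportsSubset S Z

    Finite : Subset → Set
    Finite U = ∃[ l ] (∀ x → U x → x ∈ l)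

    Infinite : Subset → Set
    Infinite U = ¬ Finite U

    UniformlySupported : Subset → Set
    UniformlySupported U = ∃[ S ] (∀ x → U x → Supports S x)

    FSMUniformlyInfinite : Subset → Set₁
    FSMUniformlyInfinite X =
      ∃[ U ] (U ⊆ X × UniformlySupported U × Infinite U)

    ℘fs : Set₁
    ℘fs = Σ Subset FinSuppSubset

    _≐fs_ : ℘fs → ℘fs → Set
    (Z , _) ≐fs (W , _) = Z ≐ W

    Subset℘ : Set₂
    Subset℘ = ℘fs → Set₁

    _⊆℘_ : Subset℘ → Subset℘ → Set₁
    𝒰 ⊆℘ 𝒳 = ∀ Z → 𝒰 Z → 𝒳 Z

    Finite℘ : Subset℘ → Set₁
    Finite℘ 𝒰 = ∃[ l ] (∀ Z → 𝒰 Z → Any (Z ≐fs_) l)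

    Infinite℘ : Subset℘ → Set₁
    Infinite℘ 𝒰 = ¬ Finite℘ 𝒰

    UniformlySupported℘ : Subset℘ → Set₁
    UniformlySupported℘ 𝒰 = ∃[ S ] (∀ Z → 𝒰 Z → SupportsSubset S (Σ.proj₁ Z))

    FSMUniformlyInfinite℘ : Subset℘ → Set₂
    FSMUniformlyInfinite℘ 𝒳 =
      ∃[ 𝒰 ] (𝒰 ⊆℘ 𝒳 × UniformlySupported℘ 𝒰 × Infinite℘ 𝒰)

    -- ℘us(X): uniformly supported subsets of X, regarded as a subset
    -- of ℘fs(Y) (a uniformly supported subset is finitely supported,
    -- so membership is decided by the underlying subset alone)
    ℘us : Subset → Subset℘
    ℘us X (Z , _) = Lift _ (Z ⊆ X × UniformlySupported Z)

module Submission where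

-- Let 𝒰 ⊆ ℘us(X) be uniformly supported by a finite
-- set S of atoms, as elements of ℘fs(Y).  The heart of the argument is a
-- support lemma: if a subset Z is supported (as a set) by S and is
-- uniformly supported, then S already supports every element of Z.  It is
-- proved by removing the atoms of a uniform support of Z not in S one at a
-- time: an atom a ∉ S can be swapped with a fresh atom f (here the atoms
-- must be infinite), and the transposition (a f) maps Z to itself.
-- Consequently every member of 𝒰 is contained in
--   U = { y ∈ X : S supports y },
-- a uniformly supported subset of X, which is finite because X is not
-- FSM uniformly infinite.  Finally, a family of subsets of a finite list l
-- is finite: each member coincides with the extension of a sublist of l,
-- and (by excluded middle) one representative per sublist covers it.

open import Defs
open import Level using (0ℓ; suc; Lift; lift; lower)
open import Relation.Nullary using (¬_; yes; no; Dec; does)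
open import Relation.Unary using (Decidable)
open import Relation.Binary.Definitions using (DecidableEquality)
open import Axiom.ExcludedMiddle using (ExcludedMiddle)
open import Data.Bool using (true; false)
open import Data.Product using (Σ; ∃-syntax; _×_; _,_; proj₁; proj₂)
open import Data.List using (List; []; _∷_; _++_; map; filter)
open import Data.List.Membership.Propositional using (_∈_)
open import Data.List.Membership.Propositional.Properties
  using (∈-++⁺ˡ; ∈-++⁺ʳ; ∈-map⁺; ∈-filter⁺; ∈-filter⁻)
open import Data.List.Relation.Binary.Subset.Propositional using () renaming (_⊆_ to _⊆ₗ_)
open import Data.List.Relation.Unary.Any using (Any; here; there)
open import Data.Empty using (⊥-elim)
open import Relation.Binary.PropositionalEquality
  using (_≡_; refl; sym; trans; cong; subst; module ≡-Reasoning)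

¬¬-elim : ExcludedMiddle (suc 0ℓ) → {P : Set} → ¬ ¬ P → P
¬¬-elim em {P} ¬¬p with em {Lift (suc 0ℓ) P}
... | yes (lift p) = p
... | no ¬p = ⊥-elim (¬¬p (λ p → ¬p (lift p)))

sublists : {B : Set} → List B → List (List B)
sublists [] = [] ∷ []
sublists (x ∷ l) = map (x ∷_) (sublists l) ++ sublists l

filter∈sublists : {B : Set} {P : B → Set₁} (P? : Decidable P) (l : List B) →
                  filter P? l ∈ sublists l
filter∈sublists P? [] = here refl
filter∈sublists P? (x ∷ l) with does (P? x)
... | true = ∈-++⁺ˡ (∈-map⁺ (x ∷_) (filter∈sublists P? l))
... | false = ∈-++⁺ʳ (map (x ∷_) (sublists l)) (filter∈sublists P? l)

module _ (A : Set) (_≟_ : DecidableEquality A) where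
  open FSM A _≟_
  open import Data.List.Membership.DecPropositional _≟_ using (_∈?_)

  transposition : A → A → Perm
  transposition a f = (a , f) ∷ []

  swap-left : ∀ a b → swap a b a ≡ b
  swap-left a b with a ≟ a
  ... | yes _ = refl
  ... | no a≢a = ⊥-elim (a≢a refl)

  swap-right : ∀ a b → swap a b b ≡ a
  swap-right a b with b ≟ a
  ... | yes b≡a = b≡a
  ... | no _ with b ≟ b
  ...   | yes _ = refl
  ...   | no b≢b = ⊥-elim (b≢b refl)

  swap-other : ∀ a b c → ¬ c ≡ a → ¬ c ≡ b → swap a b c ≡ c
  swap-other a b c c≢a c≢b with c ≟ a
  ... | yes c≡a = ⊥-elim (c≢a c≡a)
  ... | no _ with c ≟ b
  ...   | yes c≡b = ⊥-elim (c≢b c≡b)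
  ...   | no _ = refl

  swap-involutive : ∀ a b c → swap a b (swap a b c) ≡ c
  swap-involutive a b c = by-cases (c ≟ a) (c ≟ b)
    where
      -- case analysis on c without abstracting the goal
      by-cases : Dec (c ≡ a) → Dec (c ≡ b) → swap a b (swap a b c) ≡ c
      by-cases (yes refl) _ = trans (cong (swap c b) (swap-left c b)) (swap-right c b)
      by-cases (no _) (yes refl) = trans (cong (swap a c) (swap-right a c)) (swap-left a c)
      by-cases (no c≢a) (no c≢b) =
        trans (cong (swap a b) (swap-other a b c c≢a c≢b)) (swap-other a b c c≢a c≢b)

  atoms : Perm → List A
  atoms [] = []
  atoms ((a , b) ∷ π) = a ∷ b ∷ atoms π

  fresh-fixed : ∀ π c → ¬ c ∈ atoms π → ⟦ π ⟧ c ≡ c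
  fresh-fixed [] c _ = refl
  fresh-fixed ((a , b) ∷ π) c c∉π =
    trans (cong (swap a b) (fresh-fixed π c (λ c∈π → c∉π (there (there c∈π)))))
          (swap-other a b c (λ c≡a → c∉π (here c≡a)) (λ c≡b → c∉π (there (here c≡b))))

  ⟦++⟧ : ∀ π σ c → ⟦ π ++ σ ⟧ c ≡ ⟦ π ⟧ (⟦ σ ⟧ c)
  ⟦++⟧ [] σ c = refl
  ⟦++⟧ ((a , b) ∷ π) σ c = cong (swap a b) (⟦++⟧ π σ c)

  module _ (Y : SASet) where
    open SASet Y

    supports-mono : ∀ {T T' x} → T ⊆ₗ T' → Supports Y T x → Supports Y T' x
    supports-mono T⊆T' T-supp π πFixT' = T-supp π (λ a a∈T → πFixT' a (T⊆T' a∈T))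

    transposition-involutive : ∀ a f x →
      transposition a f · (transposition a f · x) ≡ x
    transposition-involutive a f x = begin
      τ · (τ · x)   ≡⟨ sym (·-comp τ τ x) ⟩
      (τ ++ τ) · x  ≡⟨ ·-ext (τ ++ τ) [] (swap-involutive a f) x ⟩
      [] · x        ≡⟨ ·-id x ⟩
      x             ∎
      where
        open ≡-Reasoning
        τ = transposition a f

    transposition-supports : ∀ a f T w π → Supports Y T w →
      (∀ t → t ∈ T → ⟦ π ⟧ (swap a f t) ≡ swap a f t) →
      π · (transposition a f · w) ≡ transposition a f · w
    transposition-supports a f T w π T-supp πFixτT = begin
      π · (τ · w)                ≡⟨ sym (transposition-involutive a f _) ⟩
      τ · (τ · (π · (τ · w)))    ≡⟨ cong (τ ·_) conjugate ⟩
      τ · ((τ ++ (π ++ τ)) · w)  ≡⟨ cong (τ ·_) (T-supp (τ ++ (π ++ τ)) conjFixT) ⟩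
      τ · w                      ∎
      where
        open ≡-Reasoning
        τ = transposition a f
        conjugate : τ · (π · (τ · w)) ≡ (τ ++ (π ++ τ)) · w
        conjugate = sym (trans (·-comp τ (π ++ τ) w) (cong (τ ·_) (·-comp π τ w)))
        conjFixT : Fix T (τ ++ (π ++ τ))
        conjFixT t t∈T = begin
          ⟦ τ ++ (π ++ τ) ⟧ t       ≡⟨ ⟦++⟧ τ (π ++ τ) t ⟩
          swap a f (⟦ π ++ τ ⟧ t)   ≡⟨ cong (swap a f) (⟦++⟧ π τ t) ⟩
          swap a f (⟦ π ⟧ (swap a f t)) ≡⟨ cong (swap a f) (πFixτT t t∈T) ⟩
          swap a f (swap a f t)     ≡⟨ swap-involutive a f t ⟩
          t                         ∎

    module _ (infinite : InfiniteAtoms A)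
             (S : List A) (Z : Subset Y) (S-supp : SupportsSubset Y S Z) where

      -- For a ∉ T and a given π fixing
      -- T, pick f fresh for T and π; then (a f) fixes S, so z = (a f)·w
      -- with w ∈ Z, and π fixes (a f)(a ∷ T) = f ∷ T.
      drop-atom : ∀ a T → S ⊆ₗ T →
        (∀ z → Z z → Supports Y (a ∷ T) z) → ∀ z → Z z → Supports Y T z
      drop-atom a T S⊆T aT-supp z Zz π πFixT with a ∈? T
      ... | yes a∈T = supports-mono a∷T⊆T (aT-supp z Zz) π πFixT
        where
          a∷T⊆T : (a ∷ T) ⊆ₗ T
          a∷T⊆T (here refl) = a∈T
          a∷T⊆T (there b∈T) = b∈T
      ... | no a∉T =
        subst (λ u → π · u ≡ u) (transposition-involutive a f z)
          (transposition-supports a f (a ∷ T) w π (aT-supp w Zw) πFixτaT)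
        where
          fresh = infinite (a ∷ T ++ atoms π)
          f = proj₁ fresh
          f≢a : ¬ f ≡ a
          f≢a f≡a = proj₂ fresh (here f≡a)
          f∉T : ¬ f ∈ T
          f∉T f∈T = proj₂ fresh (there (∈-++⁺ˡ f∈T))
          f∉π : ¬ f ∈ atoms π
          f∉π f∈π = proj₂ fresh (there (∈-++⁺ʳ T f∈π))
          swap-on-T : ∀ t → t ∈ T → swap a f t ≡ t
          swap-on-T t t∈T = swap-other a f t (λ { refl → a∉T t∈T }) (λ { refl → f∉T t∈T })
          τFixS : Fix S (transposition a f)
          τFixS s s∈S = swap-on-T s (S⊆T s∈S)
          w = transposition a f · z
          Zw : Z w
          Zw = proj₁ (S-supp (transposition a f) τFixS) w (z , Zz , refl)
          πFixτaT : ∀ t → t ∈ a ∷ T → ⟦ π ⟧ (swap a f t) ≡ swap a f t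
          πFixτaT t (here refl) rewrite swap-left t f = fresh-fixed π f f∉π
          πFixτaT t (there t∈T) rewrite swap-on-T t t∈T = πFixT t t∈T

      drop-atoms : ∀ L → (∀ z → Z z → Supports Y (L ++ S) z) → ∀ z → Z z → Supports Y S z
      drop-atoms [] LS-supp = LS-supp
      drop-atoms (a ∷ L) aLS-supp = drop-atoms L (drop-atom a (L ++ S) (∈-++⁺ʳ L) aLS-supp)

      uniform-support-descends : UniformlySupported Y Z → ∀ z → Z z → Supports Y S z
      uniform-support-descends (T , T-supp) =
        drop-atoms T (λ z Zz → supports-mono ∈-++⁺ˡ (T-supp z Zz))

    module _ (em : ExcludedMiddle (suc 0ℓ)) where

      extension : List Carrier → Subset Y
      extension k y = y ∈ k

      subset-as-sublist : ∀ (Z : Subset Y) l → _⊆_ Y Z (extension l) →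
        ∃[ k ] (k ∈ sublists l × _≐_ Y Z (extension k))
      subset-as-sublist Z l Z⊆l =
        filter Z? l , filter∈sublists Z? l ,
        (λ y Zy → ∈-filter⁺ Z? (Z⊆l y Zy) (lift Zy)) ,
        (λ y y∈k → lower (proj₂ (∈-filter⁻ Z? {xs = l} y∈k)))
        where
          Z? : Decidable (λ y → Lift (suc 0ℓ) (Z y))
          Z? y = em

      module _ (𝒰 : Subset℘ Y) where
        Represents : List Carrier → ℘fs Y → Set₁
        Represents k W = 𝒰 W × _≐_ Y (proj₁ W) (extension k)

        representatives : List (List Carrier) → List (℘fs Y)
        representatives [] = []
        representatives (k ∷ ks) with em {Σ (℘fs Y) (Represents k)}
        ... | yes (W , _) = W ∷ representatives ks
        ... | no _ = representatives ks

        representatives-complete : ∀ Z → 𝒰 Z → ∀ k ks → k ∈ ks →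
          _≐_ Y (proj₁ Z) (extension k) → Any (_≐fs_ Y Z) (representatives ks)
        representatives-complete Z 𝒰Z k (k' ∷ ks) k∈ Z≐k
          with em {Σ (℘fs Y) (Represents k')} | k∈
        ... | yes (W , _ , W≐k) | here refl =
          here ((λ y Zy → proj₂ W≐k y (proj₁ Z≐k y Zy)) ,
                (λ y Wy → proj₂ Z≐k y (proj₁ W≐k y Wy)))
        ... | yes _ | there k∈ks = there (representatives-complete Z 𝒰Z k ks k∈ks Z≐k)
        ... | no noRep | here refl = ⊥-elim (noRep (Z , 𝒰Z , Z≐k))
        ... | no _ | there k∈ks = representatives-complete Z 𝒰Z k ks k∈ks Z≐k

        finite-family : ∀ l → (∀ Z → 𝒰 Z → _⊆_ Y (proj₁ Z) (extension l)) → Finite℘ Y 𝒰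
        finite-family l inside = representatives (sublists l) , λ Z 𝒰Z →
          let (k , k∈ , Z≐k) = subset-as-sublist (proj₁ Z) l (inside Z 𝒰Z)
          in representatives-complete Z 𝒰Z k (sublists l) k∈ Z≐k

theorem3p2 : (A : Set) (_≟_ : DecidableEquality A) → InfiniteAtoms A →
    ExcludedMiddle (suc 0ℓ) →
    let open FSM A _≟_ in
    (Y : SASet) → Invariant Y →
    (X : Subset Y) → FinSuppSubset Y X →
    ¬ FSMUniformlyInfinite Y X →
    ¬ FSMUniformlyInfinite℘ Y (℘us Y X)
theorem3p2 A _≟_ infinite em Y _ X _ X-not-UI (𝒰 , 𝒰⊆℘us , (S , S-supp) , 𝒰-infinite) =
  𝒰-infinite (finite-family A _≟_ Y em 𝒰 (proj₁ U-finite) inside-U)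
  where
    open FSM A _≟_
    U : Subset Y
    U y = X y × Supports Y S y
    U-finite : Finite Y U
    U-finite = ¬¬-elim em λ U-infinite →
      X-not-UI (U , (λ y → proj₁) , (S , λ y → proj₂) , U-infinite)
    inside-U : ∀ Z → 𝒰 Z → ∀ y → proj₁ Z y → y ∈ proj₁ U-finite
    inside-U Z 𝒰Z y Zy = proj₂ U-finite y (Z⊆X y Zy ,
      uniform-support-descends A _≟_ Y infinite S (proj₁ Z) (S-supp Z 𝒰Z) Z-us y Zy)
      where
        Z⊆X = proj₁ (lower (𝒰⊆℘us Z 𝒰Z))
        Z-us = proj₂ (lower (𝒰⊆℘us Z 𝒰Z))
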